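{- Let $\mathcal{H}=(V,H)$ be a boolean representable simplicial complex and let $\tau\subseteq\eta$ be an equivalence relation on $V$. Let $\varphi:V\to V/\tau$ be the canonical projection. Then: (i) $\dim(\mathcal{H}/\tau)=\dim\mathcal{H}$; (ii) $\mathrm{Fl}\mathcal{H}=\{F\varphi^{ -1}: F\in\mathrm{Fl}(\mathcal{H}/\tau)\}$; (iii) $\mathrm{Fl}\mathcal{H}\cong\mathrm{Fl}(\mathcal{H}/\tau)$ (as lattices); (iv) $\mathcal{H}/\tau$ is boolean representable; (v) $\mathcal{H}/\tau$ is simple if and only if $\tau=\eta$; (vi) $\mathcal{H}$ is pure if and only if $\mathcal{H}/\tau$ is pure; (vii) $\mathcal{H}$ is a matroid if and only if $\mathcal{H}/\tau$ is a matroid; (viii) if $v,w\in V$ satisfy $v\tau\neq w\tau$, then $v - w$ is an edge of $\Gamma\mathrm{Fl}\mathcal{H}$ if and only if $v\tau - w\tau$ is an edge of $\Gamma\mathrm{Fl}(\mathcal{H}/\tau)$; (ix) for every $X\subseteq V$: $X$ is a facet of $\mathcal{H}$ if and only if $\varphi|_X$ is injective and $X\varphi$ is a facet of $\mathcal{H}/\tau$; (x) if $\mathcal{H}/\tau$ is shellable, so is $\mathcal{H}$.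
   Context: A (finite) simplicial complex is a pair $\mathcal{H}=(V,H)$ with $V$ finite nonempty and $H\subseteq 2^V$ containing all singletons and closed under subsets; maximal faces are facets; dimension of a face $I$ is $|I|-1$, and of the complex the maximum over faces; pure means all facets have the same dimension; simple means every 2-subset of $V$ is a face; a matroid is a complex satisfying: for all $I,J\in H$ with $|I|=|J|+1$ there is $i\in I\setminus J$ with $J\cup\{i\}\in H$. A boolean matrix with row set $R$ and column set $V$ is nonsingular if, after independently permuting rows and columns, it is square lower unitriangular; $X\subseteq V$ is $M$-independent if some submatrix $M[Y,X]$ is nonsingular; $\mathcal{H}$ is boolean representable if $H$ is the set of $M$-independent subsets for some boolean matrix $M$. A flat is a set $X\subseteq V$ with $I\cup\{p\}\in H$ for all $I\in H$, $I\subseteq X$, $p\in V\setminus X$; $\mathrm{Fl}\mathcal{H}$ is the lattice of flats under inclusion; $\overline{X}$ is the intersection of flats containing $X$. The graph of flats $\Gamma\mathrm{Fl}\mathcal{H}$ has vertex set $V$ and edges $p - q$ for $p\neq q$ with $\overline{\{p,q\}}\neq V$. The equivalence $\eta$ on $V$ is $a\,\eta\,b$ iff $\overline{\{a\}}=\overline{\{b\}}$. For an equivalence relation $\tau$ on $V$, $\mathcal{H}/\tau=(V/\tau,H/\tau)$ where $H/\tau=\{\{a_1\tau,\ldots,a_k\tau\}:\{a_1,\ldots,a_k\}\in H\}$. Shellable: the facets can be ordered $B_1,\ldots,B_t$ so that for $k=2,\ldots,t$, with $I(B_k)=(\bigcup_{i<k}2^{B_i})\cap 2^{B_k}$, the complex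 $(B_k,I(B_k))$ is pure of dimension $|B_k|-2$ whenever $|B_k|\geq 2$. -}

module Defs where

open import Data.Nat using (ℕ; zero; suc; _≤_; _<_)
open import Data.Bool using (Bool; true; false)
open import Data.Fin using (Fin; _≟_) renaming (_<_ to _<ᶠ_)
open import Data.Fin.Properties using (any?)
open import Data.Fin.Subset using (Subset; _∈_; _∉_; _⊆_; _∪_; ⁅_⁆; ∣_∣)
open import Data.Fin.Subset.Properties using (_∈?_)
open import Data.Vec using (tabulate; lookup)
open import Data.List using (List; []; _∷_)
open import Data.List.Relation.Unary.Any using (Any)
open import Data.List.Relation.Unary.Unique.Propositional using (Unique)
open import Data.List.Membership.Propositional using () renaming (_∈_ to _∈ˡ_)
open import Data.Product using (Σ; ∃; ∃-syntax; _×_; _,_)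
open import Data.Empty using (⊥)
open import Data.Unit using (⊤)
open import Relation.Nullary using (¬_; Dec; yes; no)
open import Relation.Nullary.Decidable using (⌊_⌋; _×-dec_)
open import Relation.Binary.PropositionalEquality using (_≡_; _≢_)
open import Function.Bundles using (_⇔_)

Faces : ℕ → Set₁
Faces n = Subset n → Set

record IsSimplicialComplex {n : ℕ} (H : Faces n) : Set where
  field
    nonempty   : 0 < n
    singletons : ∀ (v : Fin n) → H ⁅ v ⁆
    downClosed : ∀ (I J : Subset n) → J ⊆ I → H I → H J

-- Dimension: dim H = d iff the maximal face size is d+1
-- (faces of size k have dimension k-1).
HasDim : ∀ {n} → Faces n → ℕ → Set
HasDim H d = (∃[ I ] (H I × ∣ I ∣ ≡ suc d)) × (∀ I → H I → ∣ I ∣ ≤ suc d)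

IsFacet : ∀ {n} → Faces n → Subset n → Set
IsFacet H X = H X × (∀ Y → H Y → X ⊆ Y → Y ≡ X)

IsPure : ∀ {n} → Faces n → Set
IsPure H = ∀ X Y → IsFacet H X → IsFacet H Y → ∣ X ∣ ≡ ∣ Y ∣

IsSimple : ∀ {n} → Faces n → Set
IsSimple {n} H = ∀ (p q : Fin n) → p ≢ q → H (⁅ p ⁆ ∪ ⁅ q ⁆)

IsMatroid : ∀ {n} → Faces n → Set
IsMatroid H = ∀ I J → H I → H J → ∣ I ∣ ≡ suc ∣ J ∣ →
  ∃[ i ] (i ∈ I × i ∉ J × H (J ∪ ⁅ i ⁆))

-- X is M-independent iff some submatrix M[Y,X] is nonsingular, i.e.
-- there are enumerations ys of Y (rows) and xs of X (columns) without
-- repetition such that M[ys i, xs j] is lower unitriangular.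
IsMIndep : ∀ {r n} → (Fin r → Fin n → Bool) → Subset n → Set
IsMIndep {r} {n} M X =
  ∃[ k ] Σ (Fin k → Fin r) λ ys → Σ (Fin k → Fin n) λ xs →
    (∀ i j → ys i ≡ ys j → i ≡ j) ×
    (∀ i j → xs i ≡ xs j → i ≡ j) ×
    (∀ x → (x ∈ X) ⇔ (∃[ j ] (xs j ≡ x))) ×
    (∀ i → M (ys i) (xs i) ≡ true) ×
    (∀ i j → i <ᶠ j → M (ys i) (xs j) ≡ false)

IsBooleanRepresentable : ∀ {n} → Faces n → Set
IsBooleanRepresentable {n} H =
  ∃[ r ] Σ (Fin r → Fin n → Bool) λ M → ∀ X → H X ⇔ IsMIndep M X

IsFlat : ∀ {n} → Faces n → Subset n → Set
IsFlat H X = ∀ I → H I → I ⊆ X → ∀ p → p ∉ X → H (I ∪ ⁅ p ⁆)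

InClosure : ∀ {n} → Faces n → Subset n → Fin n → Set
InClosure H X x = ∀ F → IsFlat H F → X ⊆ F → x ∈ F

Eta : ∀ {n} → Faces n → Fin n → Fin n → Set
Eta H a b = ∀ x → InClosure H ⁅ a ⁆ x ⇔ InClosure H ⁅ b ⁆ x

GraphOfFlatsEdge : ∀ {n} → Faces n → Fin n → Fin n → Set
GraphOfFlatsEdge H p q = p ≢ q × ¬ (∀ x → InClosure H (⁅ p ⁆ ∪ ⁅ q ⁆) x)

image : ∀ {n m} → (Fin n → Fin m) → Subset n → Subset m
image φ X = tabulate λ y → ⌊ any? (λ x → (x ∈? X) ×-dec (φ x ≟ y)) ⌋

preimage : ∀ {n m} → (Fin n → Fin m) → Subset m → Subset n
preimage φ F = tabulate λ x → lookup F (φ x)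

InjectiveOn : ∀ {n m} → (Fin n → Fin m) → Subset n → Set
InjectiveOn φ X = ∀ x y → x ∈ X → y ∈ X → φ x ≡ φ y → x ≡ y

Surjective : ∀ {n m} → (Fin n → Fin m) → Set
Surjective φ = ∀ y → ∃[ x ] (φ x ≡ y)

-- The quotient complex H/τ, where the quotient V/τ is represented by
-- Fin m and the canonical projection by a surjection φ with kernel τ:
-- faces of H/τ are the images of faces of H.
Quotient : ∀ {n m} → (Fin n → Fin m) → Faces n → Faces m
Quotient φ H Y = ∃[ X ] (H X × Y ≡ image φ X)

-- Lattice isomorphism of the lattices of flats (an order isomorphism
-- between the posets of flats under inclusion; for lattices these are
-- exactly the lattice isomorphisms).
FlatLatticeIso : ∀ {n m} → Faces n → Faces m → Set
FlatLatticeIso {n} {m} H K =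
  Σ (Subset n → Subset m) λ f → Σ (Subset m → Subset n) λ g →
    (∀ X → IsFlat H X → IsFlat K (f X)) ×
    (∀ Y → IsFlat K Y → IsFlat H (g Y)) ×
    (∀ X → IsFlat H X → g (f X) ≡ X) ×
    (∀ Y → IsFlat K Y → f (g Y) ≡ Y) ×
    (∀ X X' → IsFlat H X → IsFlat H X' → (X ⊆ X') ⇔ (f X ⊆ f X'))

-- Shellability.  The facet list is processed left to right; `prev`
-- holds the facets B_1..B_{k-1} already seen (in reverse order).
-- I(B_k) = faces of B_k contained in some earlier B_i.
InI : ∀ {n} → List (Subset n) → Subset n → Subset n → Set
InI prev B Y = Y ⊆ B × Any (λ Bi → Y ⊆ Bi) prev

-- (B_k, I(B_k)) pure of dimension |B_k| - 2: every maximal element of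
-- I(B_k) has size |B_k| - 1.
ShellStep : ∀ {n} → List (Subset n) → Subset n → Set
ShellStep [] B = ⊤
ShellStep prev@(_ ∷ _) B =
  2 ≤ ∣ B ∣ → ∀ Y → IsFacet (InI prev B) Y → suc ∣ Y ∣ ≡ ∣ B ∣

ShellOrder : ∀ {n} → List (Subset n) → List (Subset n) → Set
ShellOrder prev [] = ⊤
ShellOrder prev (B ∷ Bs) = ShellStep prev B × ShellOrder (B ∷ prev) Bs

IsShellable : ∀ {n} → Faces n → Set
IsShellable {n} H = ∃[ Bs ]
  (Unique Bs × (∀ X → (X ∈ˡ Bs) ⇔ IsFacet H X) × ShellOrder [] Bs)

module Submission where

-- In a boolean representation M of H the zero set of every row is a flat, and two
-- vertices of a face never have equal columns.  Flats are unions of η-classes, so τ ⊆ η forces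
-- τ-related vertices to have equal columns.  Hence φ is injective on faces, M descends to a matrix
-- on V/τ representing H/τ, and X is a face of H iff φ is injective on X and Xφ is a face of H/τ.
-- Parts (i)-(ix) follow from this description of the faces, under which F ↦ Fφ and F ↦ Fφ⁻¹ are
-- mutually inverse on flats.  For (x), the facets of H are the injective lifts of the facets of
-- H/τ; list them class by class along a shelling of H/τ, lexicographically within a class.  A
-- maximal earlier face Y below a lift X either lies below a lift of an earlier class, and the
-- shelling of H/τ yields a codimension-one face of X containing Y, or it lies in a
-- lexicographically smaller lift Z of the same class; then exchanging the vertex q of X for the
-- first vertex of Z outside X (its τ-twin) gives an earlier lift containing X - q ⊇ Y.

open import Defs
open import Data.Bool using (Bool; true; false; not)
open import Data.Bool.Properties using (T-≡; not-injective) renaming (_≟_ to _≟ᵇ_)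
open import Data.Fin using (Fin; zero; suc; _≟_) renaming (_<_ to _<ᶠ_)
open import Data.Fin.Properties using (any?; all?; <-cmp; ¬∀⟶∃¬)
open import Data.Fin.Subset
  using (Subset; _∈_; _∉_; _⊆_; _∪_; _∩_; _─_; _-_; ⁅_⁆; ∣_∣; Nonempty)
  renaming (⊥ to ∅)
open import Data.Fin.Subset.Properties
  using (_∈?_; _⊆?_; _⊂?_; x∈⁅x⁆; x∈⁅y⁆⇒x≡y; x∈p∪q⁻; p⊆p∪q; q⊆p∪q;
         x∈p∩q⁺; x∈p∩q⁻; p─q⊆p; x∈p∧x∉q⇒x∈p─q; x∈p∧x≢y⇒x∈p-y; x∈p⇒∣p-x∣<∣p∣;
         ⊆-antisym; ∪-identityʳ; ∪-comm; drop-there; nonempty?; anySubset?; Empty-unique; ∣⊥∣≡0)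
open import Data.Fin.Subset.Induction using (Acc; acc; ⊃-wellFounded)
open import Data.List using (List; []; _∷_; _++_; map; filter; concatMap; reverseAcc)
open import Data.List.Membership.Propositional using (find; lose) renaming (_∈_ to _∈ˡ_)
open import Data.List.Membership.Propositional.Properties
  using (∈-map⁺; ∈-++⁺ˡ; ∈-++⁺ʳ; ∈-filter⁺; ∈-filter⁻; ∈-concatMap⁺; ∈-concatMap⁻)
open import Data.List.Relation.Unary.All as All using (All; []; _∷_)
import Data.List.Relation.Unary.All.Properties as All
open import Data.List.Relation.Unary.Any using (Any; here; there)
import Data.List.Relation.Unary.Any as Any
import Data.List.Relation.Unary.Any.Properties as Any
open import Data.List.Relation.Unary.AllPairs as AllPairs using (AllPairs; []; _∷_)
import Data.List.Relation.Unary.AllPairs.Properties as AllPairs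
open import Data.List.Relation.Unary.Unique.Propositional using (Unique)
import Data.List.Relation.Unary.Unique.Propositional.Properties as Unique
open import Data.Nat using (ℕ; zero; suc; _≤_; z≤n; s≤s)
open import Data.Nat.Properties using (suc-injective; n≮0; <-irrefl; <-asym)
open import Data.Product using (∃-syntax; _×_; _,_; proj₁; proj₂)
open import Data.Sum using (_⊎_; inj₁; inj₂)
open import Data.Unit using (tt)
open import Data.Vec using ([]; _∷_; tabulate; lookup) renaming (here to hereᵛ; there to thereᵛ)
open import Data.Vec.Properties using (≡-dec; lookup∘tabulate; []=⇒lookup; lookup⇒[]=)
open import Function using (_∘_)
open import Function.Bundles using (_⇔_; mk⇔; Equivalence)
open import Function.Properties.Equivalence using () renaming (sym to ⇔-sym)
open import Relation.Binary using (tri<; tri≈; tri>)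
open import Relation.Binary.PropositionalEquality
  using (_≡_; _≢_; refl; sym; trans; cong; cong₂; subst; module ≡-Reasoning)
open import Relation.Nullary using (¬_; Dec; yes; no; contradiction)
open import Relation.Nullary.Decidable using (_×-dec_; _→-dec_; map′; toWitness; fromWitness)

open Equivalence using (to; from)

private
  variable
    k n m r : ℕ

-- Subsets, images and preimages

∈-tabulate⁺ : ∀ {f : Fin n → Bool} {x} → f x ≡ true → x ∈ tabulate f
∈-tabulate⁺ {f = f} {x} fx = lookup⇒[]= x (tabulate f) (trans (lookup∘tabulate f x) fx)

∈-tabulate⁻ : ∀ {f : Fin n → Bool} {x} → x ∈ tabulate f → f x ≡ true
∈-tabulate⁻ {f = f} {x} x∈ = trans (sym (lookup∘tabulate f x)) ([]=⇒lookup x∈)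

x∈p∪⁅x⁆ : ∀ {p : Subset n} {x} → x ∈ p ∪ ⁅ x ⁆
x∈p∪⁅x⁆ {p = p} {x} = q⊆p∪q p ⁅ x ⁆ (x∈⁅x⁆ x)

⁅x⁆⊆p : ∀ {p : Subset n} {x} → x ∈ p → ⁅ x ⁆ ⊆ p
⁅x⁆⊆p {p = p} {x} x∈p y∈⁅x⁆ = subst (_∈ p) (sym (x∈⁅y⁆⇒x≡y x y∈⁅x⁆)) x∈p

x∈p─q⇒x∉q : ∀ {p q : Subset n} {x} → x ∈ p ─ q → x ∉ q
x∈p─q⇒x∉q {p = true ∷ p} {false ∷ q} hereᵛ ()
x∈p─q⇒x∉q {p = _ ∷ p} {_ ∷ q} (thereᵛ x∈) (thereᵛ x∈q) = x∈p─q⇒x∉q x∈ x∈q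

x∉p-x : ∀ {p : Subset n} {x} → x ∉ p - x
x∉p-x {x = x} x∈ = x∈p─q⇒x∉q x∈ (x∈⁅x⁆ x)

∣p∪⁅x⁆∣≡1+∣p∣ : ∀ {p : Subset n} {x} → x ∉ p → ∣ p ∪ ⁅ x ⁆ ∣ ≡ suc ∣ p ∣
∣p∪⁅x⁆∣≡1+∣p∣ {p = true ∷ p} {zero} x∉ = contradiction hereᵛ x∉
∣p∪⁅x⁆∣≡1+∣p∣ {p = false ∷ p} {zero} x∉ = cong (suc ∘ ∣_∣) (∪-identityʳ p)
∣p∪⁅x⁆∣≡1+∣p∣ {p = true ∷ p} {suc x} x∉ = cong suc (∣p∪⁅x⁆∣≡1+∣p∣ (x∉ ∘ thereᵛ))
∣p∪⁅x⁆∣≡1+∣p∣ {p = false ∷ p} {suc x} x∉ = ∣p∪⁅x⁆∣≡1+∣p∣ (x∉ ∘ thereᵛ)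

p-x∪⁅x⁆≡p : ∀ {p : Subset n} {x} → x ∈ p → (p - x) ∪ ⁅ x ⁆ ≡ p
p-x∪⁅x⁆≡p {p = p} {x} x∈p = ⊆-antisym ⊆p p⊆
  where
  ⊆p : (p - x) ∪ ⁅ x ⁆ ⊆ p
  ⊆p y∈ with x∈p∪q⁻ (p - x) ⁅ x ⁆ y∈
  ... | inj₁ y∈p-x = p─q⊆p p ⁅ x ⁆ y∈p-x
  ... | inj₂ y∈⁅x⁆ = ⁅x⁆⊆p x∈p y∈⁅x⁆
  p⊆ : p ⊆ (p - x) ∪ ⁅ x ⁆
  p⊆ {y} y∈p with y ≟ x
  ... | yes refl = x∈p∪⁅x⁆
  ... | no y≢x = p⊆p∪q ⁅ x ⁆ (x∈p∧x≢y⇒x∈p-y y∈p y≢x)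

1+∣p-x∣≡∣p∣ : ∀ {p : Subset n} {x} → x ∈ p → suc ∣ p - x ∣ ≡ ∣ p ∣
1+∣p-x∣≡∣p∣ {p = p} {x} x∈p =
  trans (sym (∣p∪⁅x⁆∣≡1+∣p∣ (x∉p-x {p = p}))) (cong ∣_∣ (p-x∪⁅x⁆≡p x∈p))

module _ (φ : Fin n → Fin m) where

  ∈-image⁺ : ∀ {X x y} → x ∈ X → φ x ≡ y → y ∈ image φ X
  ∈-image⁺ {X} {x} {y} x∈X φx≡y =
    ∈-tabulate⁺ (to T-≡ (fromWitness {a? = any? (λ x → (x ∈? X) ×-dec (φ x ≟ y))} (x , x∈X , φx≡y)))

  ∈-image⁻ : ∀ {X y} → y ∈ image φ X → ∃[ x ] (x ∈ X × φ x ≡ y)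
  ∈-image⁻ {X} {y} y∈ =
    toWitness {a? = any? (λ x → (x ∈? X) ×-dec (φ x ≟ y))} (from T-≡ (∈-tabulate⁻ y∈))

  ∈-preimage⁺ : ∀ {F x} → φ x ∈ F → x ∈ preimage φ F
  ∈-preimage⁺ φx∈F = ∈-tabulate⁺ ([]=⇒lookup φx∈F)

  ∈-preimage⁻ : ∀ {F x} → x ∈ preimage φ F → φ x ∈ F
  ∈-preimage⁻ {x = x} x∈ = lookup⇒[]= (φ x) _ (∈-tabulate⁻ x∈)

  image-mono : ∀ {A B} → A ⊆ B → image φ A ⊆ image φ B
  image-mono A⊆B y∈ with ∈-image⁻ y∈
  ... | x , x∈A , refl = ∈-image⁺ (A⊆B x∈A) refl

  image-∪-⁅⁆ : ∀ A a → image φ (A ∪ ⁅ a ⁆) ≡ image φ A ∪ ⁅ φ a ⁆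
  image-∪-⁅⁆ A a = ⊆-antisym ⊆∪ ∪⊆
    where
    ⊆∪ : image φ (A ∪ ⁅ a ⁆) ⊆ image φ A ∪ ⁅ φ a ⁆
    ⊆∪ y∈ with ∈-image⁻ y∈
    ... | x , x∈ , refl with x∈p∪q⁻ A ⁅ a ⁆ x∈
    ... | inj₁ x∈A = p⊆p∪q ⁅ φ a ⁆ (∈-image⁺ x∈A refl)
    ... | inj₂ x∈⁅a⁆ rewrite x∈⁅y⁆⇒x≡y a x∈⁅a⁆ = x∈p∪⁅x⁆
    ∪⊆ : image φ A ∪ ⁅ φ a ⁆ ⊆ image φ (A ∪ ⁅ a ⁆)
    ∪⊆ y∈ with x∈p∪q⁻ (image φ A) ⁅ φ a ⁆ y∈
    ... | inj₁ y∈A = image-mono (p⊆p∪q ⁅ a ⁆) y∈A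
    ... | inj₂ y∈⁅φa⁆ = ∈-image⁺ x∈p∪⁅x⁆ (sym (x∈⁅y⁆⇒x≡y (φ a) y∈⁅φa⁆))

  image-⁅⁆ : ∀ a → image φ ⁅ a ⁆ ≡ ⁅ φ a ⁆
  image-⁅⁆ a = ⊆-antisym ⊆⁅φa⁆ (λ y∈ → ∈-image⁺ (x∈⁅x⁆ a) (sym (x∈⁅y⁆⇒x≡y (φ a) y∈)))
    where
    ⊆⁅φa⁆ : image φ ⁅ a ⁆ ⊆ ⁅ φ a ⁆
    ⊆⁅φa⁆ y∈ with ∈-image⁻ y∈
    ... | x , x∈ , refl rewrite x∈⁅y⁆⇒x≡y a x∈ = x∈⁅x⁆ (φ a)

  image-pair : ∀ a b → image φ (⁅ a ⁆ ∪ ⁅ b ⁆) ≡ ⁅ φ a ⁆ ∪ ⁅ φ b ⁆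
  image-pair a b = trans (image-∪-⁅⁆ ⁅ a ⁆ b) (cong (_∪ ⁅ φ b ⁆) (image-⁅⁆ a))

  image-∩-preimage : ∀ {X T} → T ⊆ image φ X → image φ (X ∩ preimage φ T) ≡ T
  image-∩-preimage {X} {T} T⊆ = ⊆-antisym ⊆T T⊆′
    where
    ⊆T : image φ (X ∩ preimage φ T) ⊆ T
    ⊆T y∈ with ∈-image⁻ y∈
    ... | x , x∈ , refl = ∈-preimage⁻ (proj₂ (x∈p∩q⁻ X _ x∈))
    T⊆′ : T ⊆ image φ (X ∩ preimage φ T)
    T⊆′ y∈T with ∈-image⁻ (T⊆ y∈T)
    ... | x , x∈X , refl = ∈-image⁺ (x∈p∩q⁺ (x∈X , ∈-preimage⁺ y∈T)) refl

  InjectiveOn? : ∀ X → Dec (InjectiveOn φ X)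
  InjectiveOn? X = all? λ x → all? λ y →
    (x ∈? X) →-dec (y ∈? X) →-dec (φ x ≟ φ y) →-dec (x ≟ y)

  InjectiveOn-mono : ∀ {A B} → A ⊆ B → InjectiveOn φ B → InjectiveOn φ A
  InjectiveOn-mono A⊆B inj a b a∈ b∈ = inj a b (A⊆B a∈) (A⊆B b∈)

  InjectiveOn-∪-⁅⁆ : ∀ {A a} → InjectiveOn φ A → φ a ∉ image φ A → InjectiveOn φ (A ∪ ⁅ a ⁆)
  InjectiveOn-∪-⁅⁆ {A} {a} inj φa∉ x y x∈ y∈ φx≡φy with x∈p∪q⁻ A ⁅ a ⁆ x∈ | x∈p∪q⁻ A ⁅ a ⁆ y∈
  ... | inj₁ x∈A | inj₁ y∈A = inj x y x∈A y∈A φx≡φy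
  ... | inj₂ x∈⁅a⁆ | inj₂ y∈⁅a⁆ = trans (x∈⁅y⁆⇒x≡y a x∈⁅a⁆) (sym (x∈⁅y⁆⇒x≡y a y∈⁅a⁆))
  ... | inj₁ x∈A | inj₂ y∈⁅a⁆ rewrite x∈⁅y⁆⇒x≡y a y∈⁅a⁆ = contradiction (∈-image⁺ x∈A φx≡φy) φa∉
  ... | inj₂ x∈⁅a⁆ | inj₁ y∈A rewrite x∈⁅y⁆⇒x≡y a x∈⁅a⁆ = contradiction (∈-image⁺ y∈A (sym φx≡φy)) φa∉

  InjectiveOn-pair : ∀ {a b} → φ a ≢ φ b → InjectiveOn φ (⁅ a ⁆ ∪ ⁅ b ⁆)
  InjectiveOn-pair {a} {b} φa≢φb = InjectiveOn-∪-⁅⁆ ⁅a⁆-injective φb∉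
    where
    ⁅a⁆-injective : InjectiveOn φ ⁅ a ⁆
    ⁅a⁆-injective x y x∈ y∈ _ = trans (x∈⁅y⁆⇒x≡y a x∈) (sym (x∈⁅y⁆⇒x≡y a y∈))
    φb∉ : φ b ∉ image φ ⁅ a ⁆
    φb∉ φb∈ = φa≢φb (sym (x∈⁅y⁆⇒x≡y (φ a) (subst (φ b ∈_) (image-⁅⁆ a) φb∈)))

  InjectiveOn-∪-⁅⁆⇒∉image : ∀ {A a} → InjectiveOn φ (A ∪ ⁅ a ⁆) → a ∉ A → φ a ∉ image φ A
  InjectiveOn-∪-⁅⁆⇒∉image {A} {a} inj a∉A φa∈ with ∈-image⁻ φa∈
  ... | x , x∈A , φx≡φa = a∉A (subst (_∈ A) (inj x a (p⊆p∪q ⁅ a ⁆ x∈A) x∈p∪⁅x⁆ φx≡φa) x∈A)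

  ∣image∣≡∣∣ : ∀ X → InjectiveOn φ X → ∣ image φ X ∣ ≡ ∣ X ∣
  ∣image∣≡∣∣ X = go ∣ X ∣ X refl
    where
    open ≡-Reasoning
    go : ∀ k X → ∣ X ∣ ≡ k → InjectiveOn φ X → ∣ image φ X ∣ ≡ ∣ X ∣
    go k X _ inj with nonempty? X
    go k X _ inj | no X-empty = begin
      ∣ image φ X ∣ ≡⟨ cong ∣_∣ (Empty-unique image-empty) ⟩
      ∣ ∅ {m} ∣     ≡⟨ ∣⊥∣≡0 m ⟩
      0             ≡⟨ sym (∣⊥∣≡0 n) ⟩
      ∣ ∅ {n} ∣     ≡⟨ cong ∣_∣ (sym (Empty-unique X-empty)) ⟩
      ∣ X ∣         ∎
      where
      image-empty : ¬ Nonempty (image φ X)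
      image-empty (y , y∈) with ∈-image⁻ y∈
      ... | x , x∈X , _ = X-empty (x , x∈X)
    go zero X ∣X∣≡0 inj | yes (x , x∈X) = contradiction (subst (∣ X - x ∣ Data.Nat.<_) ∣X∣≡0 (x∈p⇒∣p-x∣<∣p∣ x∈X)) n≮0
    go (suc k) X ∣X∣≡1+k inj | yes (x , x∈X) = begin
      ∣ image φ X ∣                     ≡⟨ cong (∣_∣ ∘ image φ) (sym (p-x∪⁅x⁆≡p x∈X)) ⟩
      ∣ image φ ((X - x) ∪ ⁅ x ⁆) ∣       ≡⟨ cong ∣_∣ (image-∪-⁅⁆ (X - x) x) ⟩
      ∣ image φ (X - x) ∪ ⁅ φ x ⁆ ∣     ≡⟨ ∣p∪⁅x⁆∣≡1+∣p∣ φx∉ ⟩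
      suc ∣ image φ (X - x) ∣           ≡⟨ cong suc (go k (X - x) ∣X-x∣≡k (InjectiveOn-mono X-x⊆X inj)) ⟩
      suc ∣ X - x ∣                     ≡⟨ 1+∣p-x∣≡∣p∣ x∈X ⟩
      ∣ X ∣                             ∎
      where
      X-x⊆X : X - x ⊆ X
      X-x⊆X = p─q⊆p X ⁅ x ⁆
      ∣X-x∣≡k : ∣ X - x ∣ ≡ k
      ∣X-x∣≡k = suc-injective (trans (1+∣p-x∣≡∣p∣ x∈X) ∣X∣≡1+k)
      φx∉ : φ x ∉ image φ (X - x)
      φx∉ = InjectiveOn-∪-⁅⁆⇒∉image
              (subst (InjectiveOn φ) (sym (p-x∪⁅x⁆≡p x∈X)) inj) x∉p-x

  extendWith : Subset n → Subset n → Subset n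
  extendWith A W = A ∪ (W ─ preimage φ (image φ A))

  ⊆-extendWith : ∀ {A W} → A ⊆ extendWith A W
  ⊆-extendWith {W = W} = p⊆p∪q _

  extendWith-injective : ∀ {A W} → InjectiveOn φ A → InjectiveOn φ W → InjectiveOn φ (extendWith A W)
  extendWith-injective {A} {W} injA injW x y x∈ y∈ φx≡φy
    with x∈p∪q⁻ A _ x∈ | x∈p∪q⁻ A _ y∈
  ... | inj₁ x∈A | inj₁ y∈A = injA x y x∈A y∈A φx≡φy
  ... | inj₂ x∈W | inj₂ y∈W = injW x y (p─q⊆p W _ x∈W) (p─q⊆p W _ y∈W) φx≡φy
  ... | inj₁ x∈A | inj₂ y∈W =
    contradiction (∈-preimage⁺ (∈-image⁺ x∈A φx≡φy)) (x∈p─q⇒x∉q y∈W)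
  ... | inj₂ x∈W | inj₁ y∈A =
    contradiction (∈-preimage⁺ (∈-image⁺ y∈A (sym φx≡φy))) (x∈p─q⇒x∉q x∈W)

  image-extendWith : ∀ {A W} → image φ A ⊆ image φ W → image φ (extendWith A W) ≡ image φ W
  image-extendWith {A} {W} φA⊆φW = ⊆-antisym ⊆φW φW⊆
    where
    ⊆φW : image φ (extendWith A W) ⊆ image φ W
    ⊆φW y∈ with ∈-image⁻ y∈
    ... | x , x∈ , refl with x∈p∪q⁻ A _ x∈
    ... | inj₁ x∈A = φA⊆φW (∈-image⁺ x∈A refl)
    ... | inj₂ x∈W = ∈-image⁺ (p─q⊆p W _ x∈W) refl
    φW⊆ : image φ W ⊆ image φ (extendWith A W)
    φW⊆ y∈ with ∈-image⁻ y∈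
    ... | w , w∈W , refl with φ w ∈? image φ A
    ... | yes φw∈ = image-mono ⊆-extendWith φw∈
    ... | no φw∉ = ∈-image⁺ (q⊆p∪q A _ (x∈p∧x∉q⇒x∈p─q w∈W (φw∉ ∘ ∈-preimage⁻))) refl

  image-swap : ∀ {X p q} → q ∈ X → φ p ≡ φ q → image φ ((X - q) ∪ ⁅ p ⁆) ≡ image φ X
  image-swap {X} {p} {q} q∈X φp≡φq = begin
    image φ ((X - q) ∪ ⁅ p ⁆)     ≡⟨ image-∪-⁅⁆ (X - q) p ⟩
    image φ (X - q) ∪ ⁅ φ p ⁆   ≡⟨ cong (λ y → image φ (X - q) ∪ ⁅ y ⁆) φp≡φq ⟩
    image φ (X - q) ∪ ⁅ φ q ⁆   ≡⟨ image-∪-⁅⁆ (X - q) q ⟨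
    image φ ((X - q) ∪ ⁅ q ⁆)     ≡⟨ cong (image φ) (p-x∪⁅x⁆≡p q∈X) ⟩
    image φ X                   ∎
    where open ≡-Reasoning

  InjectiveOn-swap : ∀ {X p q} → InjectiveOn φ X → q ∈ X → φ p ≡ φ q → InjectiveOn φ ((X - q) ∪ ⁅ p ⁆)
  InjectiveOn-swap {X} {p} {q} inj q∈X φp≡φq =
    InjectiveOn-∪-⁅⁆ (InjectiveOn-mono (p─q⊆p X ⁅ q ⁆) inj) φp∉
    where
    φp∉ : φ p ∉ image φ (X - q)
    φp∉ φp∈ with ∈-image⁻ φp∈
    ... | x , x∈ , φx≡φp =
      x∉p-x (subst (_∈ X - q) (inj x q (p─q⊆p X ⁅ q ⁆ x∈) q∈X (trans φx≡φp φp≡φq)) x∈)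

-- Lexicographic order and maximal elements

data _<ₗₑₓ_ : Subset k → Subset k → Set where
  first : ∀ {p q : Subset k} → (true ∷ p) <ₗₑₓ (false ∷ q)
  next  : ∀ {b} {p q : Subset k} → p <ₗₑₓ q → (b ∷ p) <ₗₑₓ (b ∷ q)

<ₗₑₓ-irrefl : ∀ {p : Subset k} → ¬ (p <ₗₑₓ p)
<ₗₑₓ-irrefl (next p<p) = <ₗₑₓ-irrefl p<p

<ₗₑₓ-trans : ∀ {p q s : Subset k} → p <ₗₑₓ q → q <ₗₑₓ s → p <ₗₑₓ s
<ₗₑₓ-trans first      (next _)   = first
<ₗₑₓ-trans (next _)   first      = first
<ₗₑₓ-trans (next p<q) (next q<s) = next (<ₗₑₓ-trans p<q q<s)

<ₗₑₓ-asym : ∀ {p q : Subset k} → p <ₗₑₓ q → ¬ (q <ₗₑₓ p)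
<ₗₑₓ-asym p<q q<p = <ₗₑₓ-irrefl (<ₗₑₓ-trans p<q q<p)

<ₗₑₓ⇒firstDifference : ∀ {p q : Subset k} → p <ₗₑₓ q →
  ∃[ i ] (i ∈ p × i ∉ q × (∀ j → j <ᶠ i → j ∈ q → j ∈ p))
<ₗₑₓ⇒firstDifference first = zero , hereᵛ , (λ ()) , (λ _ ())
<ₗₑₓ⇒firstDifference (next {b = b} p<q) with <ₗₑₓ⇒firstDifference p<q
... | i , i∈p , i∉q , agree = suc i , thereᵛ i∈p , i∉q ∘ drop-there , agree′
  where
  agree′ : ∀ j → j <ᶠ suc i → j ∈ b ∷ _ → j ∈ b ∷ _
  agree′ zero    _         hereᵛ       = hereᵛ
  agree′ (suc j) (s≤s j<i) (thereᵛ j∈) = thereᵛ (agree j j<i j∈)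

firstDifference⇒<ₗₑₓ : ∀ (p q : Subset k) i → i ∈ p → i ∉ q →
  (∀ j → j <ᶠ i → (j ∈ p → j ∈ q) × (j ∈ q → j ∈ p)) → p <ₗₑₓ q
firstDifference⇒<ₗₑₓ (true ∷ p) (true ∷ q)  zero    _ i∉q _ = contradiction hereᵛ i∉q
firstDifference⇒<ₗₑₓ (true ∷ p) (false ∷ q) zero    _ _   _ = first
firstDifference⇒<ₗₑₓ (true ∷ p) (false ∷ q) (suc i) _ _   agree
  with () ← proj₁ (agree zero (s≤s z≤n)) hereᵛ
firstDifference⇒<ₗₑₓ (false ∷ p) (true ∷ q) (suc i) _ _   agree
  with () ← proj₂ (agree zero (s≤s z≤n)) hereᵛ
firstDifference⇒<ₗₑₓ (true ∷ p) (true ∷ q) (suc i) (thereᵛ i∈p) i∉q agree =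
  next (firstDifference⇒<ₗₑₓ p q i i∈p (i∉q ∘ thereᵛ) (λ j j<i → tail-agree (agree (suc j) (s≤s j<i))))
  where
  tail-agree : ∀ {j} → (suc j ∈ true ∷ p → suc j ∈ true ∷ q) × (suc j ∈ true ∷ q → suc j ∈ true ∷ p) →
               (j ∈ p → j ∈ q) × (j ∈ q → j ∈ p)
  tail-agree (pq , qp) = drop-there ∘ pq ∘ thereᵛ , drop-there ∘ qp ∘ thereᵛ
firstDifference⇒<ₗₑₓ (false ∷ p) (false ∷ q) (suc i) (thereᵛ i∈p) i∉q agree =
  next (firstDifference⇒<ₗₑₓ p q i i∈p (i∉q ∘ thereᵛ) (λ j j<i → tail-agree (agree (suc j) (s≤s j<i))))
  where
  tail-agree : ∀ {j} → (suc j ∈ false ∷ p → suc j ∈ false ∷ q) × (suc j ∈ false ∷ q → suc j ∈ false ∷ p) →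
               (j ∈ p → j ∈ q) × (j ∈ q → j ∈ p)
  tail-agree (pq , qp) = drop-there ∘ pq ∘ thereᵛ , drop-there ∘ qp ∘ thereᵛ

allSubsets : ∀ k → List (Subset k)
allSubsets zero    = [] ∷ []
allSubsets (suc k) = map (true ∷_) (allSubsets k) ++ map (false ∷_) (allSubsets k)

∈-allSubsets : ∀ (p : Subset k) → p ∈ˡ allSubsets k
∈-allSubsets []        = here refl
∈-allSubsets (true ∷ p)  = ∈-++⁺ˡ (∈-map⁺ (true ∷_) (∈-allSubsets p))
∈-allSubsets {suc k} (false ∷ p) = ∈-++⁺ʳ (map (true ∷_) (allSubsets k)) (∈-map⁺ (false ∷_) (∈-allSubsets p))

allSubsets-sorted : ∀ k → AllPairs _<ₗₑₓ_ (allSubsets k)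
allSubsets-sorted zero    = [] ∷ []
allSubsets-sorted (suc k) = AllPairs.++⁺ (AllPairs.map⁺ (AllPairs.map next (allSubsets-sorted k)))
                                        (AllPairs.map⁺ (AllPairs.map next (allSubsets-sorted k)))
                                        (All.map⁺ (All.tabulate (λ _ → All.map⁺ (All.tabulate (λ _ → first)))))

module _ {P : Subset k → Set} (P? : ∀ X → Dec (P X)) where

  facet-⊇ : ∀ Y → P Y → ∃[ T ] (Y ⊆ T × IsFacet P T)
  facet-⊇ Y = go Y (⊃-wellFounded Y)
    where
    go : ∀ Y → Acc _ Y → P Y → ∃[ T ] (Y ⊆ T × IsFacet P T)
    go Y (acc larger) PY with anySubset? (λ Z → P? Z ×-dec (Y ⊂? Z))
    ... | yes (Z , PZ , Y⊂Z) with go Z (larger Y⊂Z) PZ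
    ...   | T , Z⊆T , T-facet = T , Z⊆T ∘ proj₁ Y⊂Z , T-facet
    go Y _ PY | no ∄larger = Y , (λ y∈ → y∈) , PY , maximal
      where
      maximal : ∀ Z → P Z → Y ⊆ Z → Z ≡ Y
      maximal Z PZ Y⊆Z = ⊆-antisym Z⊆Y Y⊆Z
        where
        Z⊆Y : Z ⊆ Y
        Z⊆Y {x} x∈Z with x ∈? Y
        ... | yes x∈Y = x∈Y
        ... | no x∉Y = contradiction (Z , PZ , (λ {_} → Y⊆Z) , x , x∈Z , x∉Y) ∄larger

-- Shelling orders

EarlierFaces : (Subset k → Set) → Subset k → Subset k → Set
EarlierFaces Earlier B Y = Y ⊆ B × ∃[ Z ] (Earlier Z × Y ⊆ Z)

ShellCondition : (Subset k → Set) → Subset k → Set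
ShellCondition Earlier B =
  2 ≤ ∣ B ∣ → ∀ Y → IsFacet (EarlierFaces Earlier B) Y → suc ∣ Y ∣ ≡ ∣ B ∣

IsFacet-cong : ∀ {P P′ : Subset k → Set} → (∀ Y → P Y ⇔ P′ Y) → ∀ {Y} → IsFacet P Y → IsFacet P′ Y
IsFacet-cong P⇔P′ (PY , maximal) = to (P⇔P′ _) PY , λ Z P′Z Y⊆Z → maximal Z (from (P⇔P′ Z) P′Z) Y⊆Z

EarlierFaces-cong : ∀ {E E′ : Subset k → Set} {B} → (∀ Z → E Z ⇔ E′ Z) →
  ∀ Y → EarlierFaces E B Y ⇔ EarlierFaces E′ B Y
EarlierFaces-cong E⇔E′ Y = mk⇔
  (λ { (Y⊆B , Z , EZ , Y⊆Z) → Y⊆B , Z , to (E⇔E′ Z) EZ , Y⊆Z })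
  (λ { (Y⊆B , Z , E′Z , Y⊆Z) → Y⊆B , Z , from (E⇔E′ Z) E′Z , Y⊆Z })

ShellCondition-cong : ∀ {E E′ : Subset k → Set} {B} → (∀ Z → E Z ⇔ E′ Z) →
  ShellCondition E B → ShellCondition E′ B
ShellCondition-cong E⇔E′ cond two Y Y-facet =
  cond two Y (IsFacet-cong (λ W → ⇔-sym (EarlierFaces-cong E⇔E′ W)) Y-facet)

InI⇔EarlierFaces : ∀ (prev : List (Subset k)) B Y → InI prev B Y ⇔ EarlierFaces (_∈ˡ prev) B Y
InI⇔EarlierFaces prev B Y = mk⇔
  (λ { (Y⊆B , Y⊆prev) → Y⊆B , find Y⊆prev })
  (λ { (Y⊆B , Z , Z∈ , Y⊆Z) → Y⊆B , lose Z∈ (λ {_} → Y⊆Z) })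

ShellCondition⇒ShellStep : ∀ (prev : List (Subset k)) {B} → ShellCondition (_∈ˡ prev) B → ShellStep prev B
ShellCondition⇒ShellStep []          cond = tt
ShellCondition⇒ShellStep prev@(_ ∷ _) cond two Y Y-facet =
  cond two Y (IsFacet-cong (InI⇔EarlierFaces prev _) Y-facet)

ShellStep⇒ShellCondition : ∀ (prev : List (Subset k)) {B C} →
  C ∈ˡ prev → ShellStep prev B → ShellCondition (_∈ˡ prev) B
ShellStep⇒ShellCondition prev@(_ ∷ _) _ step two Y Y-facet =
  step two Y (IsFacet-cong (λ W → ⇔-sym (InI⇔EarlierFaces prev _ W)) Y-facet)

EarlierFaces? : ∀ (prev : List (Subset k)) B Y → Dec (EarlierFaces (_∈ˡ prev) B Y)
EarlierFaces? prev B Y =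
  map′ (to (InI⇔EarlierFaces prev B Y)) (from (InI⇔EarlierFaces prev B Y)) ((Y ⊆? B) ×-dec Any.any? (Y ⊆?_) prev)

ShellOrder-++ : ∀ (prev xs : List (Subset k)) {ys} →
  ShellOrder prev xs → ShellOrder (reverseAcc prev xs) ys → ShellOrder prev (xs ++ ys)
ShellOrder-++ prev []       _             order = order
ShellOrder-++ prev (x ∷ xs) (step , order) order′ = step , ShellOrder-++ (x ∷ prev) xs order order′

-- Sortedness makes the members of L preceding X exactly those lexicographically below X.
ShellOrder-sorted : ∀ {Base : Subset k → Set} prev L →
  (∀ Z → Z ∈ˡ prev ⇔ Base Z) → AllPairs _<ₗₑₓ_ L →
  (∀ X → X ∈ˡ L → ShellCondition (λ Z → Base Z ⊎ (Z ∈ˡ L × Z <ₗₑₓ X)) X) →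
  ShellOrder prev L
ShellOrder-sorted prev []      _     _               _    = tt
ShellOrder-sorted {Base = Base} prev (X ∷ L) prev⇔Base (X<L ∷ sorted) cond =
  ShellCondition⇒ShellStep prev (ShellCondition-cong earlier⇔prev (cond X (here refl))) ,
  ShellOrder-sorted (X ∷ prev) L prev′⇔Base′ sorted cond′
  where
  earlier⇔prev : ∀ Z → (Base Z ⊎ (Z ∈ˡ X ∷ L × Z <ₗₑₓ X)) ⇔ Z ∈ˡ prev
  earlier⇔prev Z = mk⇔ earlier⇒prev (inj₁ ∘ to (prev⇔Base Z))
    where
    earlier⇒prev : Base Z ⊎ (Z ∈ˡ X ∷ L × Z <ₗₑₓ X) → Z ∈ˡ prev
    earlier⇒prev (inj₁ BaseZ)              = from (prev⇔Base Z) BaseZ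
    earlier⇒prev (inj₂ (here refl , X<X))  = contradiction X<X <ₗₑₓ-irrefl
    earlier⇒prev (inj₂ (there Z∈L , Z<X)) = contradiction Z<X (<ₗₑₓ-asym (All.lookup X<L Z∈L))
  prev′⇔Base′ : ∀ Z → Z ∈ˡ X ∷ prev ⇔ (Base Z ⊎ Z ≡ X)
  prev′⇔Base′ Z = mk⇔ (λ { (here refl) → inj₂ refl ; (there Z∈) → inj₁ (to (prev⇔Base Z) Z∈) })
                     (λ { (inj₁ BaseZ) → there (from (prev⇔Base Z) BaseZ) ; (inj₂ refl) → here refl })
  cond′ : ∀ X′ → X′ ∈ˡ L → ShellCondition (λ Z → (Base Z ⊎ Z ≡ X) ⊎ (Z ∈ˡ L × Z <ₗₑₓ X′)) X′
  cond′ X′ X′∈L = ShellCondition-cong regroup (cond X′ (there X′∈L))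
    where
    regroup : ∀ Z → (Base Z ⊎ (Z ∈ˡ X ∷ L × Z <ₗₑₓ X′)) ⇔ ((Base Z ⊎ Z ≡ X) ⊎ (Z ∈ˡ L × Z <ₗₑₓ X′))
    regroup Z = mk⇔
      (λ { (inj₁ BaseZ) → inj₁ (inj₁ BaseZ)
         ; (inj₂ (here refl , _)) → inj₁ (inj₂ refl)
         ; (inj₂ (there Z∈L , Z<X′)) → inj₂ (Z∈L , Z<X′) })
      (λ { (inj₁ (inj₁ BaseZ)) → inj₁ BaseZ
         ; (inj₁ (inj₂ refl)) → inj₂ (here refl , All.lookup X<L X′∈L)
         ; (inj₂ (Z∈L , Z<X′)) → inj₂ (there Z∈L , Z<X′) })

-- Flats and boolean matrices

module _ {H : Faces n} where

  Eta-flat : ∀ {F a b} → IsFlat H F → a ∈ F → Eta H a b → b ∈ F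
  Eta-flat {F} {a} {b} F-flat a∈F a≈b = from (a≈b b) b∈cl⁅b⁆ F F-flat (⁅x⁆⊆p a∈F)
    where
    b∈cl⁅b⁆ : InClosure H ⁅ b ⁆ b
    b∈cl⁅b⁆ _ _ ⁅b⁆⊆ = ⁅b⁆⊆ (x∈⁅x⁆ b)

  sameFlats⇒Eta : ∀ {a b} → (∀ {F} → IsFlat H F → a ∈ F → b ∈ F) → (∀ {F} → IsFlat H F → b ∈ F → a ∈ F) →
    Eta H a b
  sameFlats⇒Eta a⇒b b⇒a x = mk⇔ (transfer b⇒a) (transfer a⇒b)
    where
    transfer : ∀ {c d} → (∀ {F} → IsFlat H F → d ∈ F → c ∈ F) → InClosure H ⁅ c ⁆ x → InClosure H ⁅ d ⁆ x
    transfer d⇒c x∈cl⁅c⁆ F F-flat ⁅d⁆⊆F = x∈cl⁅c⁆ F F-flat (⁅x⁆⊆p (d⇒c F-flat (⁅d⁆⊆F (x∈⁅x⁆ _))))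

module _ (M : Fin r → Fin n → Bool) where

  SameColumn : Fin n → Fin n → Set
  SameColumn a b = ∀ ρ → M ρ a ≡ M ρ b

  IsMIndep-SameColumn⇒≡ : ∀ {X a b} → IsMIndep M X → a ∈ X → b ∈ X → SameColumn a b → a ≡ b
  IsMIndep-SameColumn⇒≡ {a = a} {b} (_ , ys , xs , _ , _ , xs-enum , diag , upper) a∈X b∈X same
    with to (xs-enum a) a∈X | to (xs-enum b) b∈X
  ... | i , refl | j , refl with <-cmp i j
  ... | tri≈ _ i≡j _ = cong xs i≡j
  ... | tri< i<j _ _ = contradiction (trans (sym (diag i)) (trans (same (ys i)) (upper i j i<j))) λ ()
  ... | tri> _ _ j<i = contradiction (trans (sym (diag j)) (trans (sym (same (ys j))) (upper j i j<i))) λ ()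

  -- A row vanishing on X but not at p supplies a new first pivot.
  IsMIndep-∪-⁅⁆ : ∀ {X ρ p} → IsMIndep M X → (∀ {x} → x ∈ X → M ρ x ≡ false) → M ρ p ≡ true →
    IsMIndep M (X ∪ ⁅ p ⁆)
  IsMIndep-∪-⁅⁆ {X} {ρ} {p} (k , ys , xs , ys-inj , xs-inj , xs-enum , diag , upper) ρ-vanishes ρp≡true =
    suc k , ys′ , xs′ , ys′-inj , xs′-inj , xs′-enum , diag′ , upper′
    where
    ys′ : Fin (suc k) → Fin r
    ys′ zero    = ρ
    ys′ (suc i) = ys i
    xs′ : Fin (suc k) → Fin n
    xs′ zero    = p
    xs′ (suc i) = xs i
    xs∈X : ∀ j → xs j ∈ X
    xs∈X j = from (xs-enum (xs j)) (j , refl)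
    ρ≢ys : ∀ j → ρ ≢ ys j
    ρ≢ys j ρ≡ysj = contradiction (trans (sym (diag j)) (trans (cong (λ σ → M σ (xs j)) (sym ρ≡ysj)) (ρ-vanishes (xs∈X j)))) λ ()
    p≢xs : ∀ j → p ≢ xs j
    p≢xs j p≡xsj = contradiction (trans (sym ρp≡true) (trans (cong (M ρ) p≡xsj) (ρ-vanishes (xs∈X j)))) λ ()
    ys′-inj : ∀ i j → ys′ i ≡ ys′ j → i ≡ j
    ys′-inj zero    zero    _ = refl
    ys′-inj zero    (suc j) e = contradiction e (ρ≢ys j)
    ys′-inj (suc i) zero    e = contradiction (sym e) (ρ≢ys i)
    ys′-inj (suc i) (suc j) e = cong suc (ys-inj i j e)
    xs′-inj : ∀ i j → xs′ i ≡ xs′ j → i ≡ j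
    xs′-inj zero    zero    _ = refl
    xs′-inj zero    (suc j) e = contradiction e (p≢xs j)
    xs′-inj (suc i) zero    e = contradiction (sym e) (p≢xs i)
    xs′-inj (suc i) (suc j) e = cong suc (xs-inj i j e)
    xs′-enum : ∀ x → (x ∈ X ∪ ⁅ p ⁆) ⇔ (∃[ j ] (xs′ j ≡ x))
    xs′-enum x = mk⇔ enumerated (λ { (zero , refl) → x∈p∪⁅x⁆ ; (suc j , refl) → p⊆p∪q ⁅ p ⁆ (xs∈X j) })
      where
      enumerated : x ∈ X ∪ ⁅ p ⁆ → ∃[ j ] (xs′ j ≡ x)
      enumerated x∈ with x∈p∪q⁻ X ⁅ p ⁆ x∈
      ... | inj₁ x∈X = let j , xsj≡x = to (xs-enum x) x∈X in suc j , xsj≡x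
      ... | inj₂ x∈⁅p⁆ = zero , sym (x∈⁅y⁆⇒x≡y p x∈⁅p⁆)
    diag′ : ∀ i → M (ys′ i) (xs′ i) ≡ true
    diag′ zero    = ρp≡true
    diag′ (suc i) = diag i
    upper′ : ∀ i j → i <ᶠ j → M (ys′ i) (xs′ j) ≡ false
    upper′ zero    (suc j) _         = ρ-vanishes (xs∈X j)
    upper′ (suc i) (suc j) (s≤s i<j) = upper i j i<j

module _ {n′} (M : Fin r → Fin n → Bool) (M′ : Fin r → Fin n′ → Bool)
         (f : Fin n → Fin n′) (same-columns : ∀ ρ x → M′ ρ (f x) ≡ M ρ x) where

  IsMIndep-image : ∀ {X} → IsMIndep M X → InjectiveOn f X × IsMIndep M′ (image f X)
  IsMIndep-image {X} indep@(k , ys , xs , ys-inj , xs-inj , xs-enum , diag , upper) =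
    f-inj , k , ys , f ∘ xs , ys-inj , fxs-inj , fxs-enum ,
    (λ i → trans (same-columns _ _) (diag i)) , (λ i j i<j → trans (same-columns _ _) (upper i j i<j))
    where
    xs∈X : ∀ j → xs j ∈ X
    xs∈X j = from (xs-enum (xs j)) (j , refl)
    f-inj : InjectiveOn f X
    f-inj a b a∈X b∈X fa≡fb = IsMIndep-SameColumn⇒≡ M indep a∈X b∈X
      (λ ρ → trans (sym (same-columns ρ a)) (trans (cong (M′ ρ) fa≡fb) (same-columns ρ b)))
    fxs-inj : ∀ i j → f (xs i) ≡ f (xs j) → i ≡ j
    fxs-inj i j e = xs-inj i j (f-inj _ _ (xs∈X i) (xs∈X j) e)
    fxs-enum : ∀ y → (y ∈ image f X) ⇔ (∃[ j ] (f (xs j) ≡ y))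
    fxs-enum y = mk⇔ enumerated (λ (j , e) → ∈-image⁺ f (xs∈X j) e)
      where
      enumerated : y ∈ image f X → ∃[ j ] (f (xs j) ≡ y)
      enumerated y∈ with ∈-image⁻ f y∈
      ... | x , x∈X , refl = let j , xsj≡x = to (xs-enum x) x∈X in j , cong f xsj≡x

  IsMIndep-image⁻ : ∀ {X} → InjectiveOn f X → IsMIndep M′ (image f X) → IsMIndep M X
  IsMIndep-image⁻ {X} f-inj (k , ys , zs , ys-inj , zs-inj , zs-enum , diag , upper) =
    k , ys , xs , ys-inj , xs-inj , xs-enum ,
    (λ i → trans (sym (same-columns _ _)) (trans (cong (M′ _) (f-xs i)) (diag i))) ,
    (λ i j i<j → trans (sym (same-columns _ _)) (trans (cong (M′ _) (f-xs j)) (upper i j i<j)))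
    where
    preimage-of : ∀ j → ∃[ x ] (x ∈ X × f x ≡ zs j)
    preimage-of j = ∈-image⁻ f (from (zs-enum (zs j)) (j , refl))
    xs : Fin k → Fin n
    xs j = proj₁ (preimage-of j)
    xs∈X : ∀ j → xs j ∈ X
    xs∈X j = proj₁ (proj₂ (preimage-of j))
    f-xs : ∀ j → f (xs j) ≡ zs j
    f-xs j = proj₂ (proj₂ (preimage-of j))
    xs-inj : ∀ i j → xs i ≡ xs j → i ≡ j
    xs-inj i j e = zs-inj i j (trans (sym (f-xs i)) (trans (cong f e) (f-xs j)))
    xs-enum : ∀ x → (x ∈ X) ⇔ (∃[ j ] (xs j ≡ x))
    xs-enum x = mk⇔ enumerated (λ { (j , refl) → xs∈X j })
      where
      enumerated : x ∈ X → ∃[ j ] (xs j ≡ x)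
      enumerated x∈X with to (zs-enum (f x)) (∈-image⁺ f x∈X refl)
      ... | j , zsj≡fx = j , f-inj _ _ (xs∈X j) x∈X (trans (f-xs j) zsj≡fx)

module BooleanRepresentation {H : Faces n} (sc : IsSimplicialComplex H)
  (M : Fin r → Fin n → Bool) (represents : ∀ X → H X ⇔ IsMIndep M X) where

  open IsSimplicialComplex sc

  zeros : Fin r → Subset n
  zeros ρ = tabulate (not ∘ M ρ)

  ∈-zeros⁺ : ∀ {ρ x} → M ρ x ≡ false → x ∈ zeros ρ
  ∈-zeros⁺ Mρx≡false = ∈-tabulate⁺ (cong not Mρx≡false)

  ∈-zeros⁻ : ∀ {ρ x} → x ∈ zeros ρ → M ρ x ≡ false
  ∈-zeros⁻ x∈ = not-injective (∈-tabulate⁻ x∈)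

  ∉-zeros⁻ : ∀ {ρ x} → x ∉ zeros ρ → M ρ x ≡ true
  ∉-zeros⁻ {ρ} {x} x∉ with M ρ x in Mρx
  ... | true  = refl
  ... | false = contradiction (∈-zeros⁺ Mρx) x∉

  zeros-flat : ∀ ρ → IsFlat H (zeros ρ)
  zeros-flat ρ I I-face I⊆zeros p p∉zeros = from (represents _)
    (IsMIndep-∪-⁅⁆ M (to (represents I) I-face) (∈-zeros⁻ ∘ I⊆zeros) (∉-zeros⁻ p∉zeros))

  face-SameColumn⇒≡ : ∀ {X a b} → H X → a ∈ X → b ∈ X → SameColumn M a b → a ≡ b
  face-SameColumn⇒≡ X-face = IsMIndep-SameColumn⇒≡ M (to (represents _) X-face)

  Eta⇒SameColumn : ∀ {a b} → Eta H a b → SameColumn M a b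
  Eta⇒SameColumn {a} {b} a≈b ρ with M ρ a in Mρa | M ρ b in Mρb
  ... | true  | true  = refl
  ... | false | false = refl
  ... | false | true  = contradiction (trans (sym Mρb) (∈-zeros⁻ (Eta-flat (zeros-flat ρ) (∈-zeros⁺ Mρa) a≈b))) λ ()
  ... | true  | false = contradiction (trans (sym Mρa) (∈-zeros⁻ (Eta-flat (zeros-flat ρ) (∈-zeros⁺ Mρb) (Eta-sym a≈b)))) λ ()
    where
    Eta-sym : Eta H a b → Eta H b a
    Eta-sym a≈b x = ⇔-sym (a≈b x)

  SameColumn⇒Eta : ∀ {a b} → SameColumn M a b → Eta H a b
  SameColumn⇒Eta {a} {b} same = sameFlats⇒Eta (SameColumn-flat (sym ∘ same)) (SameColumn-flat same)
    where
    SameColumn-flat : ∀ {c d F} → SameColumn M c d → IsFlat H F → d ∈ F → c ∈ F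
    SameColumn-flat {c} {d} {F} same F-flat d∈F with c ∈? F
    ... | yes c∈F = c∈F
    ... | no  c∉F = contradiction (subst (_∈ F) (sym (face-SameColumn⇒≡ pair-face (q⊆p∪q _ _ (x∈⁅x⁆ c)) (p⊆p∪q _ (x∈⁅x⁆ d)) same)) d∈F) c∉F
      where
      pair-face : H (⁅ d ⁆ ∪ ⁅ c ⁆)
      pair-face = F-flat ⁅ d ⁆ (singletons d) (⁅x⁆⊆p d∈F) c c∉F

  ¬Eta⇒pair-face : ∀ {a b} → ¬ Eta H a b → H (⁅ a ⁆ ∪ ⁅ b ⁆)
  ¬Eta⇒pair-face {a} {b} a≉b with ¬∀⟶∃¬ r (λ ρ → M ρ a ≡ M ρ b) (λ ρ → M ρ a ≟ᵇ M ρ b) (a≉b ∘ SameColumn⇒Eta)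
  ... | ρ , Mρa≢Mρb with M ρ a in Mρa | M ρ b in Mρb
  ... | true  | true  = contradiction refl Mρa≢Mρb
  ... | false | false = contradiction refl Mρa≢Mρb
  ... | false | true  = zeros-flat ρ ⁅ a ⁆ (singletons a) (⁅x⁆⊆p (∈-zeros⁺ Mρa)) b
                          (λ b∈ → contradiction (trans (sym Mρb) (∈-zeros⁻ b∈)) λ ())
  ... | true  | false = subst H (∪-comm ⁅ b ⁆ ⁅ a ⁆)
                          (zeros-flat ρ ⁅ b ⁆ (singletons b) (⁅x⁆⊆p (∈-zeros⁺ Mρb)) a
                            (λ a∈ → contradiction (trans (sym Mρa) (∈-zeros⁻ a∈)) λ ()))

-- The quotient complex

module QuotientOf {H : Faces n} {φ : Fin n → Fin m} (sc : IsSimplicialComplex H)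
  (M : Fin r → Fin n → Bool) (represents : ∀ X → H X ⇔ IsMIndep M X)
  (surjective : Surjective φ) (φ⇒Eta : ∀ a b → φ a ≡ φ b → Eta H a b) where

  open IsSimplicialComplex sc
  open BooleanRepresentation sc M represents

  H/φ : Faces m
  H/φ = Quotient φ H

  section : Fin m → Fin n
  section y = proj₁ (surjective y)

  φ∘section : ∀ y → φ (section y) ≡ y
  φ∘section y = proj₂ (surjective y)

  image-image-section : ∀ Y → image φ (image section Y) ≡ Y
  image-image-section Y = ⊆-antisym ⊆Y (λ {y} y∈Y → ∈-image⁺ φ (∈-image⁺ section y∈Y refl) (φ∘section y))
    where
    ⊆Y : image φ (image section Y) ⊆ Y
    ⊆Y y∈ with ∈-image⁻ φ y∈
    ... | x , x∈ , refl with ∈-image⁻ section x∈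
    ... | y , y∈Y , refl = subst (_∈ Y) (sym (φ∘section y)) y∈Y

  image-preimage : ∀ F → image φ (preimage φ F) ≡ F
  image-preimage F = ⊆-antisym ⊆F F⊆
    where
    ⊆F : image φ (preimage φ F) ⊆ F
    ⊆F y∈ with ∈-image⁻ φ y∈
    ... | x , x∈ , refl = ∈-preimage⁻ φ x∈
    F⊆ : F ⊆ image φ (preimage φ F)
    F⊆ {y} y∈F = ∈-image⁺ φ (∈-preimage⁺ φ (subst (_∈ F) (sym (φ∘section y)) y∈F)) (φ∘section y)

  quotientMatrix : Fin r → Fin m → Bool
  quotientMatrix ρ y = M ρ (section y)

  quotientMatrix-columns : ∀ ρ x → quotientMatrix ρ (φ x) ≡ M ρ x
  quotientMatrix-columns ρ x = Eta⇒SameColumn (φ⇒Eta _ _ (φ∘section (φ x))) ρ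

  quotient-represented : ∀ Y → H/φ Y ⇔ IsMIndep quotientMatrix Y
  quotient-represented Y = mk⇔
    (λ { (W , W-face , refl) → proj₂ (IsMIndep-image M quotientMatrix φ quotientMatrix-columns (to (represents W) W-face)) })
    (λ indep → image section Y ,
               from (represents _) (proj₂ (IsMIndep-image quotientMatrix M section (λ _ _ → refl) indep)) ,
               sym (image-image-section Y))

  face-injective : ∀ {X} → H X → InjectiveOn φ X
  face-injective X-face = proj₁ (IsMIndep-image M quotientMatrix φ quotientMatrix-columns (to (represents _) X-face))

  face⇔ : ∀ X → H X ⇔ (InjectiveOn φ X × H/φ (image φ X))
  face⇔ X = mk⇔ (λ X-face → face-injective X-face , X , X-face , refl)
    (λ (inj , φX-face) → from (represents X)
      (IsMIndep-image⁻ M quotientMatrix φ quotientMatrix-columns inj (to (quotient-represented _) φX-face)))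

  face-∣image∣ : ∀ {X} → H X → ∣ image φ X ∣ ≡ ∣ X ∣
  face-∣image∣ X-face = ∣image∣≡∣∣ φ _ (face-injective X-face)

  flat-saturated : ∀ {F a b} → IsFlat H F → a ∈ F → φ a ≡ φ b → b ∈ F
  flat-saturated F-flat a∈F φa≡φb = Eta-flat F-flat a∈F (φ⇒Eta _ _ φa≡φb)

  image-⊆⇒⊆ : ∀ {X F} → IsFlat H F → image φ X ⊆ image φ F → X ⊆ F
  image-⊆⇒⊆ F-flat φX⊆φF x∈X with ∈-image⁻ φ (φX⊆φF (∈-image⁺ φ x∈X refl))
  ... | y , y∈F , φy≡φx = flat-saturated F-flat y∈F φy≡φx

  preimage-image-flat : ∀ {F} → IsFlat H F → preimage φ (image φ F) ≡ F
  preimage-image-flat {F} F-flat = ⊆-antisym ⊆F (λ x∈F → ∈-preimage⁺ φ (∈-image⁺ φ x∈F refl))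
    where
    ⊆F : preimage φ (image φ F) ⊆ F
    ⊆F x∈ with ∈-image⁻ φ (∈-preimage⁻ φ x∈)
    ... | y , y∈F , φy≡φx = flat-saturated F-flat y∈F φy≡φx

  image-flat : ∀ {F} → IsFlat H F → IsFlat H/φ (image φ F)
  image-flat {F} F-flat _ (I , I-face , refl) φI⊆φF y y∉φF =
    I ∪ ⁅ section y ⁆ , F-flat I I-face (image-⊆⇒⊆ F-flat φI⊆φF) (section y) section-y∉F , φI+y≡
    where
    section-y∉F : section y ∉ F
    section-y∉F sy∈F = y∉φF (∈-image⁺ φ sy∈F (φ∘section y))
    φI+y≡ : image φ I ∪ ⁅ y ⁆ ≡ image φ (I ∪ ⁅ section y ⁆)
    φI+y≡ = trans (cong (λ z → image φ I ∪ ⁅ z ⁆) (sym (φ∘section y))) (sym (image-∪-⁅⁆ φ I (section y)))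

  preimage-flat : ∀ {F} → IsFlat H/φ F → IsFlat H (preimage φ F)
  preimage-flat {F} F-flat I I-face I⊆ p p∉ = from (face⇔ _)
    (InjectiveOn-∪-⁅⁆ φ (face-injective I-face) (φp∉F ∘ φI⊆F) ,
     subst H/φ (sym (image-∪-⁅⁆ φ I p)) (F-flat (image φ I) (I , I-face , refl) φI⊆F (φ p) φp∉F))
    where
    φI⊆F : image φ I ⊆ F
    φI⊆F y∈ with ∈-image⁻ φ y∈
    ... | x , x∈I , refl = ∈-preimage⁻ φ (I⊆ x∈I)
    φp∉F : φ p ∉ F
    φp∉F = p∉ ∘ ∈-preimage⁺ φ

  flat⇔ : ∀ X → IsFlat H X ⇔ (∃[ F ] (IsFlat H/φ F × X ≡ preimage φ F))
  flat⇔ X = mk⇔ (λ X-flat → image φ X , image-flat X-flat , sym (preimage-image-flat X-flat))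
                (λ { (F , F-flat , refl) → preimage-flat F-flat })

  flatLatticeIso : FlatLatticeIso H H/φ
  flatLatticeIso = image φ , preimage φ , (λ _ → image-flat) , (λ _ → preimage-flat) ,
    (λ _ → preimage-image-flat) , (λ F _ → image-preimage F) ,
    λ _ _ _ X′-flat → mk⇔ (image-mono φ) (image-⊆⇒⊆ X′-flat)

  InClosure-image⇔ : ∀ {X x} → InClosure H X x ⇔ InClosure H/φ (image φ X) (φ x)
  InClosure-image⇔ {X} {x} = mk⇔ down up
    where
    down : InClosure H X x → InClosure H/φ (image φ X) (φ x)
    down x∈cl F F-flat φX⊆F =
      ∈-preimage⁻ φ (x∈cl _ (preimage-flat F-flat) (λ x∈X → ∈-preimage⁺ φ (φX⊆F (∈-image⁺ φ x∈X refl))))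
    up : InClosure H/φ (image φ X) (φ x) → InClosure H X x
    up φx∈cl F F-flat X⊆F = image-⊆⇒⊆ F-flat φ⁅x⁆⊆φF (x∈⁅x⁆ x)
      where
      φ⁅x⁆⊆φF : image φ ⁅ x ⁆ ⊆ image φ F
      φ⁅x⁆⊆φF = subst (_⊆ image φ F) (sym (image-⁅⁆ φ x))
                  (⁅x⁆⊆p (φx∈cl _ (image-flat F-flat) (image-mono φ X⊆F)))

  spans⇔ : ∀ X → (∀ x → InClosure H X x) ⇔ (∀ y → InClosure H/φ (image φ X) y)
  spans⇔ X = mk⇔
    (λ spans y → subst (InClosure H/φ (image φ X)) (φ∘section y) (to InClosure-image⇔ (spans (section y))))
    (λ spans x → from InClosure-image⇔ (spans (φ x)))

  edge⇔ : ∀ v w → φ v ≢ φ w → GraphOfFlatsEdge H v w ⇔ GraphOfFlatsEdge H/φ (φ v) (φ w)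
  edge⇔ v w φv≢φw = mk⇔
    (λ (_ , ¬spans) → φv≢φw , ¬spans ∘ from (spans⇔ _) ∘ subst (λ Y → ∀ y → InClosure H/φ Y y) (sym (image-pair φ v w)))
    (λ (_ , ¬spans) → φv≢φw ∘ cong φ , ¬spans ∘ subst (λ Y → ∀ y → InClosure H/φ Y y) (image-pair φ v w) ∘ to (spans⇔ _))

  dim⇔ : ∀ d → HasDim H d ⇔ HasDim H/φ d
  dim⇔ d = mk⇔
    (λ ((I , I-face , ∣I∣≡) , bounded) →
      (image φ I , (I , I-face , refl) , trans (face-∣image∣ I-face) ∣I∣≡) ,
      λ { _ (W , W-face , refl) → subst (_≤ suc d) (sym (face-∣image∣ W-face)) (bounded W W-face) })
    (λ { ((_ , (W , W-face , refl) , ∣Y∣≡) , bounded) →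
      (W , W-face , trans (sym (face-∣image∣ W-face)) ∣Y∣≡) ,
      λ I I-face → subst (_≤ suc d) (face-∣image∣ I-face) (bounded _ (I , I-face , refl)) })

  facet⇒ : ∀ {X} → IsFacet H X → InjectiveOn φ X × IsFacet H/φ (image φ X)
  facet⇒ {X} (X-face , X-maximal) = face-injective X-face , (X , X-face , refl) , maximal
    where
    maximal : ∀ Y → H/φ Y → image φ X ⊆ Y → Y ≡ image φ X
    maximal _ (W , W-face , refl) φX⊆φW = begin
      image φ W                  ≡⟨ image-extendWith φ φX⊆φW ⟨
      image φ (extendWith φ X W) ≡⟨ cong (image φ) (X-maximal _ X+W-face (⊆-extendWith φ)) ⟩
      image φ X                  ∎
      where
      open ≡-Reasoning
      X+W-face : H (extendWith φ X W)
      X+W-face = from (face⇔ _)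
        (extendWith-injective φ (face-injective X-face) (face-injective W-face) ,
         subst H/φ (sym (image-extendWith φ φX⊆φW)) (W , W-face , refl))

  facet⇐ : ∀ {X} → InjectiveOn φ X → IsFacet H/φ (image φ X) → IsFacet H X
  facet⇐ {X} inj (φX-face , φX-maximal) = from (face⇔ X) (inj , φX-face) , maximal
    where
    maximal : ∀ Y → H Y → X ⊆ Y → Y ≡ X
    maximal Y Y-face X⊆Y = ⊆-antisym Y⊆X X⊆Y
      where
      φY≡φX : image φ Y ≡ image φ X
      φY≡φX = φX-maximal _ (Y , Y-face , refl) (image-mono φ X⊆Y)
      Y⊆X : Y ⊆ X
      Y⊆X {y} y∈Y with ∈-image⁻ φ (subst (φ y ∈_) φY≡φX (∈-image⁺ φ y∈Y refl))
      ... | x , x∈X , φx≡φy = subst (_∈ X) (face-injective Y-face x y (X⊆Y x∈X) y∈Y φx≡φy) x∈X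

  facet⇔ : ∀ X → IsFacet H X ⇔ (InjectiveOn φ X × IsFacet H/φ (image φ X))
  facet⇔ X = mk⇔ facet⇒ (λ (inj , φX-facet) → facet⇐ inj φX-facet)

  quotientFacet⇒lift : ∀ {Y} → IsFacet H/φ Y → ∃[ W ] (IsFacet H W × image φ W ≡ Y)
  quotientFacet⇒lift Y-facet@((W , W-face , refl) , _) = W , facet⇐ (face-injective W-face) Y-facet , refl

  pure⇔ : IsPure H ⇔ IsPure H/φ
  pure⇔ = mk⇔ down up
    where
    down : IsPure H → IsPure H/φ
    down pure Y₁ Y₂ Y₁-facet Y₂-facet with quotientFacet⇒lift Y₁-facet | quotientFacet⇒lift Y₂-facet
    ... | W₁ , W₁-facet , refl | W₂ , W₂-facet , refl =
      trans (face-∣image∣ (proj₁ W₁-facet))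
            (trans (pure W₁ W₂ W₁-facet W₂-facet) (sym (face-∣image∣ (proj₁ W₂-facet))))
    up : IsPure H/φ → IsPure H
    up pure X₁ X₂ X₁-facet X₂-facet =
      trans (sym (face-∣image∣ (proj₁ X₁-facet)))
            (trans (pure _ _ (proj₂ (facet⇒ X₁-facet)) (proj₂ (facet⇒ X₂-facet))) (face-∣image∣ (proj₁ X₂-facet)))

  matroid⇔ : IsMatroid H ⇔ IsMatroid H/φ
  matroid⇔ = mk⇔ down up
    where
    down : IsMatroid H → IsMatroid H/φ
    down exchange _ _ (I , I-face , refl) (J , J-face , refl) ∣φI∣≡1+∣φJ∣
      with exchange I J I-face J-face
             (trans (sym (face-∣image∣ I-face)) (trans ∣φI∣≡1+∣φJ∣ (cong suc (face-∣image∣ J-face))))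
    ... | i , i∈I , i∉J , J+i-face =
      φ i , ∈-image⁺ φ i∈I refl , InjectiveOn-∪-⁅⁆⇒∉image φ (face-injective J+i-face) i∉J ,
      (J ∪ ⁅ i ⁆ , J+i-face , sym (image-∪-⁅⁆ φ J i))
    up : IsMatroid H/φ → IsMatroid H
    up exchange I J I-face J-face ∣I∣≡1+∣J∣
      with exchange (image φ I) (image φ J) (I , I-face , refl) (J , J-face , refl)
             (trans (face-∣image∣ I-face) (trans ∣I∣≡1+∣J∣ (cong suc (sym (face-∣image∣ J-face)))))
    ... | y , y∈φI , y∉φJ , φJ+y-face with ∈-image⁻ φ y∈φI
    ... | i , i∈I , refl =
      i , i∈I , (λ i∈J → y∉φJ (∈-image⁺ φ i∈J refl)) ,
      from (face⇔ _) (InjectiveOn-∪-⁅⁆ φ (face-injective J-face) y∉φJ ,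
                      subst H/φ (sym (image-∪-⁅⁆ φ J i)) φJ+y-face)

  simple⇔ : IsSimple H/φ ⇔ (∀ a b → (φ a ≡ φ b) ⇔ Eta H a b)
  simple⇔ = mk⇔ down up
    where
    down : IsSimple H/φ → ∀ a b → (φ a ≡ φ b) ⇔ Eta H a b
    down simple a b = mk⇔ (φ⇒Eta a b) Eta⇒φ
      where
      Eta⇒φ : Eta H a b → φ a ≡ φ b
      Eta⇒φ a≈b with φ a ≟ φ b
      ... | yes φa≡φb = φa≡φb
      ... | no  φa≢φb = cong φ (face-SameColumn⇒≡ pair-face (p⊆p∪q _ (x∈⁅x⁆ a)) (q⊆p∪q _ _ (x∈⁅x⁆ b))
                                  (Eta⇒SameColumn a≈b))
        where
        pair-face : H (⁅ a ⁆ ∪ ⁅ b ⁆)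
        pair-face = from (face⇔ _)
          (InjectiveOn-pair φ φa≢φb , subst H/φ (sym (image-pair φ a b)) (simple (φ a) (φ b) φa≢φb))
    up : (∀ a b → (φ a ≡ φ b) ⇔ Eta H a b) → IsSimple H/φ
    up φ⇔Eta p q p≢q = subst H/φ pair≡ (proj₂ (to (face⇔ _) (¬Eta⇒pair-face ¬Eta)))
      where
      ¬Eta : ¬ Eta H (section p) (section q)
      ¬Eta sp≈sq = p≢q (trans (sym (φ∘section p)) (trans (from (φ⇔Eta _ _) sp≈sq) (φ∘section q)))
      pair≡ : image φ (⁅ section p ⁆ ∪ ⁅ section q ⁆) ≡ ⁅ p ⁆ ∪ ⁅ q ⁆
      pair≡ = trans (image-pair φ _ _) (cong₂ (λ a b → ⁅ a ⁆ ∪ ⁅ b ⁆) (φ∘section p) (φ∘section q))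

  quotient-booleanRepresentable : IsBooleanRepresentable H/φ
  quotient-booleanRepresentable = r , quotientMatrix , quotient-represented

  Lift : Subset m → Subset n → Set
  Lift B X = InjectiveOn φ X × image φ X ≡ B

  Lift? : ∀ B X → Dec (Lift B X)
  Lift? B X = InjectiveOn? φ X ×-dec ≡-dec _≟ᵇ_ (image φ X) B

  lifts : Subset m → List (Subset n)
  lifts B = filter (Lift? B) (allSubsets n)

  ∈-lifts⇔ : ∀ {B X} → X ∈ˡ lifts B ⇔ Lift B X
  ∈-lifts⇔ {B} {X} = mk⇔ (proj₂ ∘ ∈-filter⁻ (Lift? B) {xs = allSubsets n}) (∈-filter⁺ (Lift? B) (∈-allSubsets X))

  lifts-sorted : ∀ B → AllPairs _<ₗₑₓ_ (lifts B)
  lifts-sorted B = AllPairs.filter⁺ (Lift? B) (allSubsets-sorted n)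

  ∈-concatMap-lifts⇔ : ∀ {Bs X} → X ∈ˡ concatMap lifts Bs ⇔ (∃[ B ] (B ∈ˡ Bs × Lift B X))
  ∈-concatMap-lifts⇔ {Bs} = mk⇔
    (λ X∈ → let B , B∈ , X∈lifts = find (∈-concatMap⁻ lifts {xs = Bs} X∈) in B , B∈ , to ∈-lifts⇔ X∈lifts)
    (λ (B , B∈ , X-lift) → ∈-concatMap⁺ lifts (lose B∈ (from ∈-lifts⇔ X-lift)))

  concatMap-lifts-unique : ∀ Bs → Unique Bs → Unique (concatMap lifts Bs)
  concatMap-lifts-unique []       []               = []
  concatMap-lifts-unique (B ∷ Bs) (B∉Bs ∷ Bs-unique) =
    Unique.++⁺ (AllPairs.map (λ X<X′ X≡X′ → <ₗₑₓ-irrefl (subst (_<ₗₑₓ _) X≡X′ X<X′)) (lifts-sorted B))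
               (concatMap-lifts-unique Bs Bs-unique) disjoint
    where
    disjoint : ∀ {X} → ¬ (X ∈ˡ lifts B × X ∈ˡ concatMap lifts Bs)
    disjoint (X∈lifts , X∈rest) with to ∈-concatMap-lifts⇔ X∈rest
    ... | B′ , B′∈Bs , _ , φX≡B′ = All.lookup B∉Bs B′∈Bs (trans (sym (proj₂ (to ∈-lifts⇔ X∈lifts))) φX≡B′)

  lift-facet : ∀ {B X} → IsFacet H/φ B → Lift B X → IsFacet H X
  lift-facet B-facet (X-inj , refl) = facet⇐ X-inj B-facet

  LiftOfEarlier : List (Subset m) → Subset n → Set
  LiftOfEarlier prevQ Z = InjectiveOn φ Z × image φ Z ∈ˡ prevQ

  -- X′ trades q for the first point p of Z not in X, where φ q ≡ φ p.
  earlierLift-swap : ∀ {B X Z Y} → Lift B X → Z ∈ˡ lifts B → Z <ₗₑₓ X → Y ⊆ X → Y ⊆ Z →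
    ∃[ q ] (q ∈ X × Y ⊆ X - q × ∃[ X′ ] (X′ ∈ˡ lifts B × X′ <ₗₑₓ X × X - q ⊆ X′))
  earlierLift-swap {B} {X} {Z} {Y} (X-inj , φX≡B) Z∈lifts Z<X Y⊆X Y⊆Z
    with <ₗₑₓ⇒firstDifference Z<X | to ∈-lifts⇔ Z∈lifts
  ... | p , p∈Z , p∉X , agree | Z-inj , φZ≡B
    with ∈-image⁻ φ (subst (φ p ∈_) (trans φZ≡B (sym φX≡B)) (∈-image⁺ φ p∈Z refl))
  ... | q , q∈X , φq≡φp = q , q∈X , Y⊆X-q , X′ , X′∈lifts , X′<X , p⊆p∪q ⁅ p ⁆
    where
    q∉Z : q ∉ Z
    q∉Z q∈Z = p∉X (subst (_∈ X) (Z-inj q p q∈Z p∈Z φq≡φp) q∈X)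
    p<q : p <ᶠ q
    p<q with <-cmp q p
    ... | tri< q<p _ _ = contradiction (agree q q<p q∈X) q∉Z
    ... | tri≈ _ q≡p _ = contradiction (subst (_∈ X) q≡p q∈X) p∉X
    ... | tri> _ _ p<q = p<q
    Y⊆X-q : Y ⊆ X - q
    Y⊆X-q y∈Y = x∈p∧x≢y⇒x∈p-y (Y⊆X y∈Y) (λ { refl → q∉Z (Y⊆Z y∈Y) })
    X′ : Subset n
    X′ = (X - q) ∪ ⁅ p ⁆
    X′∈lifts : X′ ∈ˡ lifts B
    X′∈lifts = from ∈-lifts⇔
      (InjectiveOn-swap φ X-inj q∈X (sym φq≡φp) , trans (image-swap φ q∈X (sym φq≡φp)) φX≡B)
    agree-below-p : ∀ j → j <ᶠ p → (j ∈ X′ → j ∈ X) × (j ∈ X → j ∈ X′)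
    agree-below-p j j<p = X′⇒X , X⇒X′
      where
      X′⇒X : j ∈ X′ → j ∈ X
      X′⇒X j∈X′ with x∈p∪q⁻ (X - q) ⁅ p ⁆ j∈X′
      ... | inj₁ j∈X-q = p─q⊆p X ⁅ q ⁆ j∈X-q
      ... | inj₂ j∈⁅p⁆ = contradiction (cong Data.Fin.toℕ (x∈⁅y⁆⇒x≡y p j∈⁅p⁆)) (λ j≡p → <-irrefl j≡p j<p)
      X⇒X′ : j ∈ X → j ∈ X′
      X⇒X′ j∈X = p⊆p∪q ⁅ p ⁆ (x∈p∧x≢y⇒x∈p-y j∈X (λ { refl → <-asym j<p p<q }))
    X′<X : X′ <ₗₑₓ X
    X′<X = firstDifference⇒<ₗₑₓ X′ X p x∈p∪⁅x⁆ p∉X agree-below-p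

  earlierClass-codim1 : ∀ {prevQ B X Z Y} → ShellStep prevQ B → (∀ B′ → B′ ∈ˡ prevQ → H/φ B′) →
    Lift B X → 2 ≤ ∣ X ∣ → image φ Z ∈ˡ prevQ → Y ⊆ X → Y ⊆ Z →
    ∃[ W ] (W ⊆ X × (∃[ V ] (LiftOfEarlier prevQ V × W ⊆ V)) × Y ⊆ W × suc ∣ W ∣ ≡ ∣ X ∣)
  earlierClass-codim1 {prevQ} {B} {X} {Z} {Y} stepQ prev-faces (X-inj , refl) 2≤∣X∣ φZ∈prev Y⊆X Y⊆Z
    with facet-⊇ (EarlierFaces? prevQ B) (image φ Y)
           (image-mono φ Y⊆X , image φ Z , φZ∈prev , image-mono φ Y⊆Z)
  ... | T , φY⊆T , T-facet@((T⊆B , B′ , B′∈prev , T⊆B′) , _) with prev-faces B′ B′∈prev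
  ... | W₀ , W₀-face , refl =
    Zs , Zs⊆X , (extendWith φ Zs W₀ , W-lift , ⊆-extendWith φ) , Y⊆Zs , 1+∣Zs∣≡∣X∣
    where
    Zs : Subset n
    Zs = X ∩ preimage φ T
    Zs⊆X : Zs ⊆ X
    Zs⊆X = proj₁ ∘ x∈p∩q⁻ X _
    Zs-inj : InjectiveOn φ Zs
    Zs-inj = InjectiveOn-mono φ Zs⊆X X-inj
    φZs≡T : image φ Zs ≡ T
    φZs≡T = image-∩-preimage φ T⊆B
    W-lift : LiftOfEarlier prevQ (extendWith φ Zs W₀)
    W-lift = extendWith-injective φ Zs-inj (face-injective W₀-face) ,
             subst (_∈ˡ prevQ) (sym (image-extendWith φ (subst (_⊆ image φ W₀) (sym φZs≡T) T⊆B′))) B′∈prev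
    Y⊆Zs : Y ⊆ Zs
    Y⊆Zs y∈Y = x∈p∩q⁺ (Y⊆X y∈Y , ∈-preimage⁺ φ (φY⊆T (∈-image⁺ φ y∈Y refl)))
    open ≡-Reasoning
    1+∣Zs∣≡∣X∣ : suc ∣ Zs ∣ ≡ ∣ X ∣
    1+∣Zs∣≡∣X∣ = begin
      suc ∣ Zs ∣           ≡⟨ cong suc (∣image∣≡∣∣ φ Zs Zs-inj) ⟨
      suc ∣ image φ Zs ∣   ≡⟨ cong (suc ∘ ∣_∣) φZs≡T ⟩
      suc ∣ T ∣            ≡⟨ ShellStep⇒ShellCondition prevQ B′∈prev stepQ
                                (subst (2 ≤_) (sym (∣image∣≡∣∣ φ X X-inj)) 2≤∣X∣) T T-facet ⟩
      ∣ image φ X ∣        ≡⟨ ∣image∣≡∣∣ φ X X-inj ⟩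
      ∣ X ∣                ∎

  lift-ShellCondition : ∀ prevQ B X → ShellStep prevQ B → (∀ B′ → B′ ∈ˡ prevQ → H/φ B′) → Lift B X →
    ShellCondition (λ Z → LiftOfEarlier prevQ Z ⊎ (Z ∈ˡ lifts B × Z <ₗₑₓ X)) X
  lift-ShellCondition prevQ B X stepQ prev-faces X-lift 2≤∣X∣ Y ((Y⊆X , Z , inj₁ (_ , φZ∈prev) , Y⊆Z) , Y-maximal)
    with earlierClass-codim1 stepQ prev-faces X-lift 2≤∣X∣ φZ∈prev Y⊆X Y⊆Z
  ... | W , W⊆X , (V , V-lift , W⊆V) , Y⊆W , 1+∣W∣≡∣X∣ =
    subst (λ U → suc ∣ U ∣ ≡ ∣ X ∣) (Y-maximal W (W⊆X , V , inj₁ V-lift , W⊆V) Y⊆W) 1+∣W∣≡∣X∣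
  lift-ShellCondition prevQ B X stepQ prev-faces X-lift 2≤∣X∣ Y ((Y⊆X , Z , inj₂ (Z∈lifts , Z<X) , Y⊆Z) , Y-maximal)
    with earlierLift-swap X-lift Z∈lifts Z<X Y⊆X Y⊆Z
  ... | q , q∈X , Y⊆X-q , X′ , X′∈lifts , X′<X , X-q⊆X′ =
    subst (λ U → suc ∣ U ∣ ≡ ∣ X ∣) (Y-maximal (X - q) (p─q⊆p X ⁅ q ⁆ , X′ , inj₂ (X′∈lifts , X′<X) , X-q⊆X′) Y⊆X-q)
          (1+∣p-x∣≡∣p∣ q∈X)

  ShellOrder-lifts : ∀ (prevQ : List (Subset m)) (prevH : List (Subset n)) Bs →
    ShellOrder prevQ Bs → (∀ B → B ∈ˡ prevQ → H/φ B) → (∀ B → B ∈ˡ Bs → H/φ B) →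
    (∀ Z → Z ∈ˡ prevH ⇔ LiftOfEarlier prevQ Z) → ShellOrder prevH (concatMap lifts Bs)
  ShellOrder-lifts prevQ prevH []       _                _          _     _       = tt
  ShellOrder-lifts prevQ prevH (B ∷ Bs) (stepQ , orderQ) prev-faces faces prevH⇔ =
    ShellOrder-++ prevH (lifts B)
      (ShellOrder-sorted prevH (lifts B) prevH⇔ (lifts-sorted B)
        (λ X X∈lifts → lift-ShellCondition prevQ B X stepQ prev-faces (to ∈-lifts⇔ X∈lifts)))
      (ShellOrder-lifts (B ∷ prevQ) (reverseAcc prevH (lifts B)) Bs orderQ prev-faces′ (λ B′ → faces B′ ∘ there) prevH′⇔)
    where
    prev-faces′ : ∀ B′ → B′ ∈ˡ B ∷ prevQ → H/φ B′
    prev-faces′ _  (here refl)  = faces B (here refl)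
    prev-faces′ B′ (there B′∈) = prev-faces B′ B′∈
    prevH′⇔ : ∀ Z → Z ∈ˡ reverseAcc prevH (lifts B) ⇔ LiftOfEarlier (B ∷ prevQ) Z
    prevH′⇔ Z = mk⇔ (earlier ∘ Any.reverseAcc⁻ prevH (lifts B)) (Any.reverseAcc⁺ prevH (lifts B) ∘ listed)
      where
      earlier : Z ∈ˡ prevH ⊎ Z ∈ˡ lifts B → LiftOfEarlier (B ∷ prevQ) Z
      earlier (inj₁ Z∈prevH)  = let Z-inj , φZ∈ = to (prevH⇔ Z) Z∈prevH in Z-inj , there φZ∈
      earlier (inj₂ Z∈lifts) = let Z-inj , φZ≡B = to ∈-lifts⇔ Z∈lifts in Z-inj , here φZ≡B
      listed : LiftOfEarlier (B ∷ prevQ) Z → Z ∈ˡ prevH ⊎ Z ∈ˡ lifts B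
      listed (Z-inj , here φZ≡B)  = inj₂ (from ∈-lifts⇔ (Z-inj , φZ≡B))
      listed (Z-inj , there φZ∈) = inj₁ (from (prevH⇔ Z) (Z-inj , φZ∈))

  shellable⇐ : IsShellable H/φ → IsShellable H
  shellable⇐ (Bs , Bs-unique , Bs⇔facets , orderQ) =
    concatMap lifts Bs , concatMap-lifts-unique Bs Bs-unique , lifts⇔facets ,
    ShellOrder-lifts [] [] Bs orderQ (λ _ ()) (λ B B∈ → proj₁ (to (Bs⇔facets B) B∈))
      (λ Z → mk⇔ (λ ()) λ ())
    where
    lifts⇔facets : ∀ X → X ∈ˡ concatMap lifts Bs ⇔ IsFacet H X
    lifts⇔facets X = mk⇔
      (λ X∈ → let B , B∈ , X-lift = to ∈-concatMap-lifts⇔ X∈ in lift-facet (to (Bs⇔facets B) B∈) X-lift)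
      (λ X-facet → let X-inj , φX-facet = facet⇒ X-facet in
                   from ∈-concatMap-lifts⇔ (image φ X , from (Bs⇔facets _) φX-facet , X-inj , refl))

proposition4p2 : ∀ {n m : ℕ} (H : Faces n) (φ : Fin n → Fin m) →
    IsSimplicialComplex H →
    IsBooleanRepresentable H →
    Surjective φ →
    (∀ a b → φ a ≡ φ b → Eta H a b) →
    (∀ d → HasDim H d ⇔ HasDim (Quotient φ H) d) ×
    (∀ X → IsFlat H X ⇔ (∃[ F ] (IsFlat (Quotient φ H) F × X ≡ preimage φ F))) ×
    FlatLatticeIso H (Quotient φ H) ×
    IsBooleanRepresentable (Quotient φ H) ×
    (IsSimple (Quotient φ H) ⇔ (∀ a b → (φ a ≡ φ b) ⇔ Eta H a b)) ×
    (IsPure H ⇔ IsPure (Quotient φ H)) ×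
    (IsMatroid H ⇔ IsMatroid (Quotient φ H)) ×
    (∀ v w → φ v ≢ φ w →
      GraphOfFlatsEdge H v w ⇔ GraphOfFlatsEdge (Quotient φ H) (φ v) (φ w)) ×
    (∀ (X : Subset n) → IsFacet H X ⇔ (InjectiveOn φ X × IsFacet (Quotient φ H) (image φ X))) ×
    (IsShellable (Quotient φ H) → IsShellable H)
proposition4p2 H φ sc (r , M , represents) surjective φ⇒Eta =
  dim⇔ , flat⇔ , flatLatticeIso , quotient-booleanRepresentable , simple⇔ ,
  pure⇔ , matroid⇔ , edge⇔ , facet⇔ , shellable⇐
  where open QuotientOf sc M represents surjective φ⇒Eta
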